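{- Let $\mathcal{A}=\langle\Sigma,Q,q_0,\delta,\alpha\rangle$ be a nice GFG-tNCW and let $\mathcal{E}\subseteq(Q\times\Sigma\times Q)\setminus\Delta$ be an allowed set. Then the GFG-tNCW $\mathcal{A}_\mathcal{E}$ is nice.
   Context: A tNCW is $\mathcal{A}=\langle \Sigma,Q,q_0,\delta,\alpha\rangle$ with finite alphabet $\Sigma$, finite state set $Q$, initial state $q_0$, total transition function $\delta:Q\times\Sigma\to 2^Q\setminus\{\emptyset\}$ with transition relation $\Delta=\{\langle q,\sigma,s\rangle: s\in\delta(q,\sigma)\}$, and $\alpha\subseteq\Delta$ ($\alpha$-transitions; the rest are $\bar\alpha$-transitions); $\delta^{\bar\alpha}(q,\sigma)$ is the set of $\sigma$-successors of $q$ via $\bar\alpha$-transitions. A run on $w=\sigma_1\sigma_2\cdots$ is $r_0r_1\cdots$ with $r_0=q_0$, $r_{i+1}\in\delta(r_i,\sigma_{i+1})$, accepting iff it traverses $\alpha$-transitions only finitely often. $\mathcal{A}^q$ is $\mathcal{A}$ with initial state $q$. $\mathcal{A}$ is GFG if there is $f:\Sigma^*\to Q$ with $f(\epsilon)=q_0$, $\langle f(u),\sigma,f(u\sigma)\rangle\in\Delta$ for all $u,\sigma$, and for every $w\in L(\mathcal{A})$ the run $f(w[1,0]),f(w[1,1]),\dots$ is accepting; a state $q$ is GFG if $\mathcal{A}^q$ is. $q\sim s$ iff $L(\mathcal{A}^q)=L(\mathcal{A}^s)$. $\mathcal{A}$ is semantically deterministic if any two $\sigma$-successors of a state are $\sim$-equivalent;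 safe deterministic if $|\delta^{\bar\alpha}(q,\sigma)|\le1$; normal if a path of $\bar\alpha$-transitions from $q$ to $s$ implies one from $s$ to $q$. A GFG-tNCW is nice if all states are reachable and GFG and it is normal, safe deterministic and semantically deterministic. A triple $\langle q,\sigma,s\rangle\in Q\times\Sigma\times Q$ is an allowed transition if there is $s'\in Q$ with $s\sim s'$ and $\langle q,\sigma,s'\rangle\in\Delta$. A set $\mathcal{E}\subseteq(Q\times\Sigma\times Q)\setminus\Delta$ is an allowed set if all its triples are allowed transitions. $\mathcal{A}_\mathcal{E}$ is the tNCW with the same $\Sigma,Q,q_0$, transition relation $\Delta\cup\mathcal{E}$ and acceptance condition $\alpha\cup\mathcal{E}$. -}

module Defs where

open import Data.Nat using (ℕ; zero; suc; _≤_)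
open import Data.Fin using (Fin)
open import Data.Bool using (Bool; true; false; _∨_)
open import Data.List using (List; []; _∷ʳ_)
open import Data.Product using (Σ; ∃; ∃-syntax; _×_; _,_; proj₁; proj₂)
open import Relation.Binary.PropositionalEquality using (_≡_; refl)

-- Alphabet Σ = Fin k, states Q = Fin n.
-- Sets of transitions (Δ, α, E) are given by their Boolean characteristic functions on Q × Σ × Q.
record TNCW (k n : ℕ) : Set where
  field
    q₀    : Fin n
    Δ     : Fin n → Fin k → Fin n → Bool
    α     : Fin n → Fin k → Fin n → Bool
    total : ∀ q σ → ∃[ s ] Δ q σ s ≡ true
    α⊆Δ   : ∀ q σ s → α q σ s ≡ true → Δ q σ s ≡ true

open TNCW public

-- infinite words σ₁σ₂⋯ : letter σ_{i+1} is  w i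
Word : ℕ → Set
Word k = ℕ → Fin k

module _ {k n : ℕ} (A : TNCW k n) where

  IsRun : Fin n → Word k → (ℕ → Fin n) → Set
  IsRun q w r = (r 0 ≡ q) × (∀ i → Δ A (r i) (w i) (r (suc i)) ≡ true)

  AcceptingRun : Word k → (ℕ → Fin n) → Set
  AcceptingRun w r = ∃[ m ] (∀ i → m ≤ i → α A (r i) (w i) (r (suc i)) ≡ false)

  Accepts : Fin n → Word k → Set
  Accepts q w = ∃[ r ] (IsRun q w r × AcceptingRun w r)

  Equiv : Fin n → Fin n → Set
  Equiv q s = ∀ w → (Accepts q w → Accepts s w) × (Accepts s w → Accepts q w)

  SafeTrans : Fin n → Fin k → Fin n → Set
  SafeTrans q σ s = (Δ A q σ s ≡ true) × (α A q σ s ≡ false)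

prefix : {k : ℕ} → Word k → ℕ → List (Fin k)
prefix w zero = []
prefix w (suc i) = prefix w i ∷ʳ w i

module _ {k n : ℕ} (A : TNCW k n) where

  GFGState : Fin n → Set
  GFGState q =
    Σ (List (Fin k) → Fin n) λ f → ((f [] ≡ q)
           × (∀ (u : List (Fin k)) σ → Δ A (f u) σ (f (u ∷ʳ σ)) ≡ true)
           × (∀ w → Accepts A q w → AcceptingRun A w (λ i → f (prefix w i))))

  IsGFG : Set
  IsGFG = GFGState (q₀ A)

  data Path : Fin n → Fin n → Set where
    here : ∀ {q} → Path q q
    step : ∀ {q σ s t} → Δ A q σ s ≡ true → Path s t → Path q t

  data SafePath : Fin n → Fin n → Set where
    here : ∀ {q} → SafePath q q
    step : ∀ {q σ s t} → SafeTrans A q σ s → SafePath s t → SafePath q t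

  Reachable : Fin n → Set
  Reachable q = Path (q₀ A) q

  SemanticallyDeterministic : Set
  SemanticallyDeterministic =
    ∀ q σ s s' → Δ A q σ s ≡ true → Δ A q σ s' ≡ true → Equiv A s s'

  SafeDeterministic : Set
  SafeDeterministic =
    ∀ q σ s s' → SafeTrans A q σ s → SafeTrans A q σ s' → s ≡ s'

  Normal : Set
  Normal = ∀ q s → SafePath q s → SafePath s q

  Nice : Set
  Nice = (∀ q → Reachable q) × (∀ q → GFGState q) × Normal
         × SafeDeterministic × SemanticallyDeterministic

  AllowedTransition : Fin n → Fin k → Fin n → Set
  AllowedTransition q σ s = ∃[ s' ] (Equiv A s s' × Δ A q σ s' ≡ true)

  AllowedSet : (Fin n → Fin k → Fin n → Bool) → Set
  AllowedSet E = ∀ q σ s → E q σ s ≡ true → (Δ A q σ s ≡ false) × AllowedTransition q σ s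

private
  ∨-introˡ : ∀ {a} b → a ≡ true → a ∨ b ≡ true
  ∨-introˡ b refl = refl

  ∨-mono : ∀ {a c} b → (a ≡ true → c ≡ true) → a ∨ b ≡ true → c ∨ b ≡ true
  ∨-mono {true}  b h _ rewrite h refl = refl
  ∨-mono {false} {true} b h p = refl
  ∨-mono {false} {false} b h p = p

extend : ∀ {k n} (A : TNCW k n) → (Fin n → Fin k → Fin n → Bool) → TNCW k n
extend A E = record
  { q₀    = q₀ A
  ; Δ     = λ q σ s → Δ A q σ s ∨ E q σ s
  ; α     = λ q σ s → α A q σ s ∨ E q σ s
  ; total = λ q σ → proj₁ (total A q σ) , ∨-introˡ _ (proj₂ (total A q σ))
  ; α⊆Δ   = λ q σ s → ∨-mono (E q σ s) (α⊆Δ A q σ s)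
  }

-- The extra transitions of A_E are all accepting (α-)transitions, so A_E has exactly the same
-- ᾱ-transitions as A; and an E-transition q -σ→ s can be traded for a Δ-transition q -σ→ s'
-- with s ∼ s'. Together these give L(A_E^q) = L(A^q) for every q: an accepting run of A_E
-- eventually uses only ᾱ-transitions of A, and its finite prefix is pulled back to A one
-- transition at a time. Every clause of niceness then transfers, the GFG strategies of A
-- being kept unchanged.
module Submission where

open import Defs
open import Data.Nat using (ℕ; zero; suc; _≤_; z≤n; s≤s)
open import Data.Fin using (Fin)
open import Data.Bool using (Bool; true; false; _∨_)
open import Data.Bool.Properties using (∨-conicalˡ; ∨-conicalʳ; not-¬)
open import Data.Product using (_,_; proj₁; proj₂)
open import Data.Sum using (_⊎_; inj₁; inj₂)
open import Function using (id; _∘_)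
open import Relation.Nullary using (contradiction)
open import Relation.Binary.PropositionalEquality using (_≡_; refl; sym; cong; cong₂; subst)

∨-introˡ : ∀ {a} b → a ≡ true → a ∨ b ≡ true
∨-introˡ b a≡true = cong (_∨ b) a≡true

∨-false : ∀ {a b} → a ≡ false → b ≡ false → a ∨ b ≡ false
∨-false = cong₂ _∨_

∨-elim : ∀ a b → a ∨ b ≡ true → a ≡ true ⊎ b ≡ true
∨-elim true  _ _   = inj₁ refl
∨-elim false _ b≡t = inj₂ b≡t

tail : ∀ {k} → Word k → Word k
tail w = w ∘ suc

module _ {k n : ℕ} (A : TNCW k n) where

  Equiv-refl : ∀ {q} → Equiv A q q
  Equiv-refl w = id , id

  Equiv-sym : ∀ {q s} → Equiv A q s → Equiv A s q
  Equiv-sym q∼s w = proj₂ (q∼s w) , proj₁ (q∼s w)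

  Equiv-trans : ∀ {q s t} → Equiv A q s → Equiv A s t → Equiv A q t
  Equiv-trans q∼s s∼t w =
    proj₁ (s∼t w) ∘ proj₁ (q∼s w) , proj₂ (q∼s w) ∘ proj₂ (s∼t w)

  accepts-∷ : ∀ {q s w} → Δ A q (w 0) s ≡ true → Accepts A s (tail w) → Accepts A q w
  accepts-∷ {q} {s} {w} q→s (r , (r0≡s , r-run) , (m , r-safe)) =
    r′ , (refl , r′-run) , (suc m , r′-safe)
    where
      r′ : ℕ → Fin n
      r′ zero    = q
      r′ (suc i) = r i

      r′-run : ∀ i → Δ A (r′ i) (w i) (r′ (suc i)) ≡ true
      r′-run zero    = subst (λ x → Δ A q (w 0) x ≡ true) (sym r0≡s) q→s
      r′-run (suc i) = r-run i

      r′-safe : ∀ i → suc m ≤ i → α A (r′ i) (w i) (r′ (suc i)) ≡ false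
      r′-safe (suc i) (s≤s m≤i) = r-safe i m≤i

module Extension {k n : ℕ} (A : TNCW k n) (E : Fin n → Fin k → Fin n → Bool)
                 (allowed : AllowedSet A E) where

  Aᴱ : TNCW k n
  Aᴱ = extend A E

  Δ⇒¬E : ∀ {q σ s} → Δ A q σ s ≡ true → E q σ s ≡ false
  Δ⇒¬E {q} {σ} {s} q→s with E q σ s in e
  ... | false = refl
  ... | true  = contradiction (proj₁ (allowed q σ s e)) (not-¬ q→s)

  Δ⇒Δᴱ : ∀ {q σ s} → Δ A q σ s ≡ true → Δ Aᴱ q σ s ≡ true
  Δ⇒Δᴱ = ∨-introˡ _

  Δᴱ⇒allowed : ∀ {q σ s} → Δ Aᴱ q σ s ≡ true → AllowedTransition A q σ s
  Δᴱ⇒allowed {q} {σ} {s} q→s with ∨-elim (Δ A q σ s) (E q σ s) q→s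
  ... | inj₁ q→ᴬs = s , Equiv-refl A , q→ᴬs
  ... | inj₂ q→ᴱs = proj₂ (allowed q σ s q→ᴱs)

  safe⇒safeᴱ : ∀ {q σ s} → SafeTrans A q σ s → SafeTrans Aᴱ q σ s
  safe⇒safeᴱ (q→s , ¬α) = Δ⇒Δᴱ q→s , ∨-false ¬α (Δ⇒¬E q→s)

  safeᴱ⇒safe : ∀ {q σ s} → SafeTrans Aᴱ q σ s → SafeTrans A q σ s
  safeᴱ⇒safe {q} {σ} {s} (q→s , ¬αᴱ) with ∨-elim (Δ A q σ s) (E q σ s) q→s
  ... | inj₁ q→ᴬs = q→ᴬs , ∨-conicalˡ _ _ ¬αᴱ
  ... | inj₂ q→ᴱs = contradiction (∨-conicalʳ _ _ ¬αᴱ) (not-¬ q→ᴱs)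

  path⇒pathᴱ : ∀ {q s} → Path A q s → Path Aᴱ q s
  path⇒pathᴱ here          = here
  path⇒pathᴱ (step q→s ps) = step (Δ⇒Δᴱ q→s) (path⇒pathᴱ ps)

  safePath⇒safePathᴱ : ∀ {q s} → SafePath A q s → SafePath Aᴱ q s
  safePath⇒safePathᴱ here          = here
  safePath⇒safePathᴱ (step q→s ps) = step (safe⇒safeᴱ q→s) (safePath⇒safePathᴱ ps)

  safePathᴱ⇒safePath : ∀ {q s} → SafePath Aᴱ q s → SafePath A q s
  safePathᴱ⇒safePath here          = here
  safePathᴱ⇒safePath (step q→s ps) = step (safeᴱ⇒safe q→s) (safePathᴱ⇒safePath ps)

  accepts⇒acceptsᴱ : ∀ {q w} → Accepts A q w → Accepts Aᴱ q w
  accepts⇒acceptsᴱ (r , (r0 , r-run) , (m , r-safe)) =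
    r , (r0 , Δ⇒Δᴱ ∘ r-run) ,
    (m , λ i m≤i → proj₂ (safe⇒safeᴱ (r-run i , r-safe i m≤i)))

  safeFromᴱ⇒accepts : ∀ m {q w r} → IsRun Aᴱ q w r →
    (∀ i → m ≤ i → α Aᴱ (r i) (w i) (r (suc i)) ≡ false) → Accepts A q w
  safeFromᴱ⇒accepts zero {r = r} (r0 , r-run) r-safe =
    r , (r0 , proj₁ ∘ safe) , (0 , λ i _ → proj₂ (safe i))
    where
      safe : ∀ i → SafeTrans A (r i) _ (r (suc i))
      safe i = safeᴱ⇒safe (r-run i , r-safe i z≤n)
  safeFromᴱ⇒accepts (suc m) {q} {w} {r} (r0 , r-run) r-safe
    with Δᴱ⇒allowed (subst (λ x → Δ Aᴱ x (w 0) (r 1) ≡ true) r0 (r-run 0))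
  ... | s′ , r1∼s′ , q→s′ =
    accepts-∷ A q→s′ (proj₁ (r1∼s′ (tail w)) accepts-tail)
    where
      accepts-tail : Accepts A (r 1) (tail w)
      accepts-tail = safeFromᴱ⇒accepts m (refl , r-run ∘ suc) (λ i m≤i → r-safe (suc i) (s≤s m≤i))

  acceptsᴱ⇒accepts : ∀ {q w} → Accepts Aᴱ q w → Accepts A q w
  acceptsᴱ⇒accepts (r , run , (m , r-safe)) = safeFromᴱ⇒accepts m run r-safe

  Equiv⇒Equivᴱ : ∀ {q s} → Equiv A q s → Equiv Aᴱ q s
  Equiv⇒Equivᴱ q∼s w =
    accepts⇒acceptsᴱ ∘ proj₁ (q∼s w) ∘ acceptsᴱ⇒accepts ,
    accepts⇒acceptsᴱ ∘ proj₂ (q∼s w) ∘ acceptsᴱ⇒accepts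

  gfgStateᴱ : ∀ {q} → GFGState A q → GFGState Aᴱ q
  gfgStateᴱ (f , f[]≡q , f-moves , f-wins) =
    f , f[]≡q , (λ u σ → Δ⇒Δᴱ (f-moves u σ)) , f-winsᴱ
    where
      f-winsᴱ : ∀ w → Accepts Aᴱ _ w → AcceptingRun Aᴱ w (λ i → f (prefix w i))
      f-winsᴱ w acc with f-wins w (acceptsᴱ⇒accepts acc)
      ... | m , f-safe =
        m , λ i m≤i → proj₂ (safe⇒safeᴱ (f-moves (prefix w i) (w i) , f-safe i m≤i))

  normalᴱ : Normal A → Normal Aᴱ
  normalᴱ normal q s =
    safePath⇒safePathᴱ ∘ normal q s ∘ safePathᴱ⇒safePath

  safeDeterministicᴱ : SafeDeterministic A → SafeDeterministic Aᴱ
  safeDeterministicᴱ safeDet q σ s s′ q→s q→s′ =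
    safeDet q σ s s′ (safeᴱ⇒safe q→s) (safeᴱ⇒safe q→s′)

  semanticallyDeterministicᴱ : SemanticallyDeterministic A → SemanticallyDeterministic Aᴱ
  semanticallyDeterministicᴱ semDet q σ s s′ q→s q→s′
    with Δᴱ⇒allowed q→s | Δᴱ⇒allowed q→s′
  ... | t , s∼t , q→t | t′ , s′∼t′ , q→t′ =
    Equiv⇒Equivᴱ (Equiv-trans A s∼t (Equiv-trans A (semDet q σ t t′ q→t q→t′) (Equiv-sym A s′∼t′)))

proposition4p10 : ∀ {k n} (A : TNCW k n) (E : Fin n → Fin k → Fin n → Bool) →
    Nice A → AllowedSet A E → Nice (extend A E)
proposition4p10 A E (reachable , gfg , normal , safeDet , semDet) allowed =
  path⇒pathᴱ ∘ reachable ,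
  gfgStateᴱ ∘ gfg ,
  normalᴱ normal ,
  safeDeterministicᴱ safeDet ,
  semanticallyDeterministicᴱ semDet
  where open Extension A E allowed
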